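{- Let $k\geq 1$ be an integer. For every graph $G$, $k\cdot i(G)\le i_{[kR]}(G)\le (k+1)\cdot i(G)$.
   Context: All graphs are finite and simple. $i(G)$ is the independent domination number: the minimum size of a set $S\subseteq V(G)$ that is independent and dominating (every vertex outside $S$ has a neighbor in $S$). For $f\colon V(G)\to\mathbb{Z}_{\ge 0}$ and $S\subseteq V(G)$, $f(S)=\sum_{v\in S}f(v)$, and $AN(v)=\{w\in N(v): f(w)\ge 1\}$. A $[k]$-Roman dominating function of $G$ is a function $f\colon V(G)\to\{0,1,\ldots,k+1\}$ such that $f(N[v])\ge k+|AN(v)|$ for every vertex $v$ with $f(v)<k$; its weight is $f(V(G))$. An independent $[k]$-Roman dominating function is one whose set of vertices with positive label is independent; $i_{[kR]}(G)$ is the minimum weight of such a function. -}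

module Defs where

open import Data.Nat using (ℕ; zero; suc; _+_; _*_; _≤_; _<_)
open import Data.Bool using (Bool; true; false; if_then_else_; _∧_)
open import Data.Fin using (Fin; zero; suc)
open import Data.Product using (Σ; _×_; ∃-syntax)
open import Data.Sum using (_⊎_)
open import Relation.Binary.PropositionalEquality using (_≡_)

record Graph : Set where
  field
    n     : ℕ
    Adj   : Fin n → Fin n → Bool
    sym   : ∀ u v → Adj u v ≡ Adj v u
    irrefl : ∀ v → Adj v v ≡ false
open Graph public

sumFin : (m : ℕ) → (Fin m → ℕ) → ℕ
sumFin zero    g = 0
sumFin (suc m) g = g zero + sumFin m (λ i → g (suc i))

card : (G : Graph) → (Fin (n G) → Bool) → ℕ
card G S = sumFin (n G) (λ v → if S v then 1 else 0)

IsIndependent : (G : Graph) → (Fin (n G) → Bool) → Set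
IsIndependent G S = ∀ u v → Adj G u v ≡ true → S u ≡ true → S v ≡ false

IsDominating : (G : Graph) → (Fin (n G) → Bool) → Set
IsDominating G S = ∀ v → S v ≡ false → ∃[ w ] (Adj G v w ≡ true × S w ≡ true)

IsIndDomSet : (G : Graph) → (Fin (n G) → Bool) → Set
IsIndDomSet G S = IsIndependent G S × IsDominating G S

IsIndDomNumber : Graph → ℕ → Set
IsIndDomNumber G m =
  (Σ (Fin (n G) → Bool) λ S → IsIndDomSet G S × card G S ≡ m)
  × (∀ S → IsIndDomSet G S → m ≤ card G S)

isPos : ℕ → Bool
isPos zero    = false
isPos (suc _) = true

weight : (G : Graph) → (Fin (n G) → ℕ) → ℕ
weight G f = sumFin (n G) f

closedNbhdSum : (G : Graph) → (Fin (n G) → ℕ) → Fin (n G) → ℕ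
closedNbhdSum G f v = f v + sumFin (n G) (λ w → if Adj G v w then f w else 0)

activeNbrs : (G : Graph) → (Fin (n G) → ℕ) → Fin (n G) → ℕ
activeNbrs G f v = sumFin (n G) (λ w → if Adj G v w ∧ isPos (f w) then 1 else 0)

IsKRDF : ℕ → (G : Graph) → (Fin (n G) → ℕ) → Set
IsKRDF k G f =
  (∀ v → f v ≤ suc k)
  × (∀ v → f v < k → k + activeNbrs G f v ≤ closedNbhdSum G f v)

IsIndependentKRDF : ℕ → (G : Graph) → (Fin (n G) → ℕ) → Set
IsIndependentKRDF k G f =
  IsKRDF k G f × (∀ u v → Adj G u v ≡ true → isPos (f u) ≡ true → isPos (f v) ≡ false)

IsIndKRomanNumber : ℕ → Graph → ℕ → Set
IsIndKRomanNumber k G m =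
  (Σ (Fin (n G) → ℕ) λ f → IsIndependentKRDF k G f × weight G f ≡ m)
  × (∀ f → IsIndependentKRDF k G f → m ≤ weight G f)

{-# OPTIONS --safe #-}
module Submission where

-- Lower bound: the positive vertices of an independent [k]-Roman dominating
-- function form an independent dominating set, and each carries label at
-- least k, because its neighbours all have label 0. (Domination is the only
-- place where k ≥ 1 is needed: it puts label-0 vertices under the Roman condition.)
-- Upper bound: labelling an independent dominating set with k + 1 and the
-- rest with 0 gives an independent [k]-Roman dominating function, since every
-- unlabelled vertex sees (k + 1)·|AN(v)| ≥ k + |AN(v)| on its neighbours.

open import Defs
open import Data.Nat using (ℕ; zero; suc; _+_; _*_; _≤_; _<_; z≤n; s≤s)
open import Data.Nat.Properties
open import Data.Bool using (Bool; true; false; if_then_else_; _∧_)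
open import Data.Fin using (Fin; zero; suc)
open import Data.Product using (_×_; _,_; ∃-syntax)
open import Relation.Binary.PropositionalEquality
  using (_≡_; refl; trans; cong; cong₂; subst; module ≡-Reasoning)
  renaming (sym to ≡-sym)
open import Relation.Nullary using (¬_; contradiction)

sumFin-cong : ∀ m {g h : Fin m → ℕ} → (∀ i → g i ≡ h i) → sumFin m g ≡ sumFin m h
sumFin-cong zero    g≗h = refl
sumFin-cong (suc m) g≗h = cong₂ _+_ (g≗h zero) (sumFin-cong m (λ i → g≗h (suc i)))

sumFin-mono : ∀ m {g h : Fin m → ℕ} → (∀ i → g i ≤ h i) → sumFin m g ≤ sumFin m h
sumFin-mono zero    g≤h = z≤n
sumFin-mono (suc m) g≤h = +-mono-≤ (g≤h zero) (sumFin-mono m (λ i → g≤h (suc i)))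

sumFin-≡0 : ∀ m {g : Fin m → ℕ} → (∀ i → g i ≡ 0) → sumFin m g ≡ 0
sumFin-≡0 zero    g≡0 = refl
sumFin-≡0 (suc m) g≡0 = cong₂ _+_ (g≡0 zero) (sumFin-≡0 m (λ i → g≡0 (suc i)))

sumFin-*ˡ : ∀ m c (g : Fin m → ℕ) → sumFin m (λ i → c * g i) ≡ c * sumFin m g
sumFin-*ˡ zero    c g = ≡-sym (*-zeroʳ c)
sumFin-*ˡ (suc m) c g = begin
  c * g zero + sumFin m (λ i → c * g (suc i)) ≡⟨ cong (c * g zero +_) (sumFin-*ˡ m c (λ i → g (suc i))) ⟩
  c * g zero + c * sumFin m (λ i → g (suc i)) ≡⟨ *-distribˡ-+ c (g zero) _ ⟨
  c * sumFin (suc m) g                        ∎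
  where open ≡-Reasoning

term≤sumFin : ∀ m (g : Fin m → ℕ) i → g i ≤ sumFin m g
term≤sumFin (suc m) g zero    = m≤m+n (g zero) _
term≤sumFin (suc m) g (suc i) = ≤-trans (term≤sumFin m (λ j → g (suc j)) i) (m≤n+m _ (g zero))

sumFin-positive⇒∃positive : ∀ m (g : Fin m → ℕ) → 1 ≤ sumFin m g → ∃[ i ] 1 ≤ g i
sumFin-positive⇒∃positive (suc m) g 1≤sum with g zero in g0≡
... | suc _ = zero , subst (1 ≤_) (≡-sym g0≡) (s≤s z≤n)
... | zero  with sumFin-positive⇒∃positive m (λ i → g (suc i)) 1≤sum
...   | i , 1≤gi = suc i , 1≤gi

isPos≡false⇒≡0 : ∀ x → isPos x ≡ false → x ≡ 0
isPos≡false⇒≡0 zero _ = refl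

1≤⇒isPos≡true : ∀ x → 1 ≤ x → isPos x ≡ true
1≤⇒isPos≡true (suc _) _ = refl

m+n≤[1+m]*n : ∀ m n → 1 ≤ n → m + n ≤ suc m * n
m+n≤[1+m]*n m n@(suc _) _ = begin
  m + n     ≡⟨ +-comm m n ⟩
  n + m     ≤⟨ +-monoʳ-≤ n (m≤m*n m n) ⟩
  n + m * n ∎
  where open ≤-Reasoning

scaledIndicator : ∀ {m} → ℕ → (Fin m → Bool) → Fin m → ℕ
scaledIndicator c S v = if S v then c else 0

scaledIndicator-≡-* : ∀ {m} c (S : Fin m → Bool) v →
                      scaledIndicator c S v ≡ c * scaledIndicator 1 S v
scaledIndicator-≡-* c S v with S v
... | true  = ≡-sym (*-identityʳ c)
... | false = ≡-sym (*-zeroʳ c)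

sumFin-scaledIndicator : ∀ m c (S : Fin m → Bool) →
                         sumFin m (scaledIndicator c S) ≡ c * sumFin m (scaledIndicator 1 S)
sumFin-scaledIndicator m c S =
  trans (sumFin-cong m (scaledIndicator-≡-* c S)) (sumFin-*ˡ m c (scaledIndicator 1 S))

support : ∀ {m} → (Fin m → ℕ) → Fin m → Bool
support f v = isPos (f v)

support-scaledIndicator : ∀ {m} c (S : Fin m → Bool) v → support (scaledIndicator (suc c) S) v ≡ S v
support-scaledIndicator c S v with S v
... | true  = refl
... | false = refl

scaledIndicator-on-support : ∀ {m} c (S : Fin m → Bool) v →
                             support (scaledIndicator c S) v ≡ true → scaledIndicator c S v ≡ c
scaledIndicator-on-support c S v with S v
... | true  = λ _ → refl
... | false = λ ()

module _ (G : Graph) where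

  openNbhdSum : (Fin (n G) → ℕ) → Fin (n G) → ℕ
  openNbhdSum f v = sumFin (n G) (λ w → if Adj G v w then f w else 0)

  1≤openNbhdSum⇒∃activeNbr : ∀ f v → 1 ≤ openNbhdSum f v →
                             ∃[ w ] (Adj G v w ≡ true × support f w ≡ true)
  1≤openNbhdSum⇒∃activeNbr f v 1≤sum
    with sumFin-positive⇒∃positive (n G) (λ w → if Adj G v w then f w else 0) 1≤sum
  ... | w , 1≤term with Adj G v w in adj
  ...   | true = w , adj , 1≤⇒isPos≡true (f w) 1≤term

  activeNbr⇒1≤activeNbrs : ∀ f v w → Adj G v w ≡ true → support f w ≡ true →
                           1 ≤ activeNbrs G f v
  activeNbr⇒1≤activeNbrs f v w adj act =
    subst (_≤ activeNbrs G f v) term≡1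
      (term≤sumFin (n G) (λ u → if Adj G v u ∧ isPos (f u) then 1 else 0) w)
    where
    term≡1 : (if Adj G v w ∧ isPos (f w) then 1 else 0) ≡ 1
    term≡1 rewrite adj | act = refl

  openNbhdSum-≡0 : ∀ f v → IsIndependent G (support f) → support f v ≡ true →
                   openNbhdSum f v ≡ 0
  openNbhdSum-≡0 f v indep act = sumFin-≡0 (n G) nbr≡0
    where
    nbr≡0 : ∀ w → (if Adj G v w then f w else 0) ≡ 0
    nbr≡0 w with Adj G v w in adj
    ... | true  = isPos≡false⇒≡0 (f w) (indep v w adj act)
    ... | false = refl

  openNbhdSum-≡-*activeNbrs : ∀ c f v → (∀ w → support f w ≡ true → f w ≡ c) →
                              openNbhdSum f v ≡ c * activeNbrs G f v
  openNbhdSum-≡-*activeNbrs c f v positive≡c =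
    trans (sumFin-cong (n G) nbr≡) (sumFin-*ˡ (n G) c _)
    where
    nbr≡ : ∀ w → (if Adj G v w then f w else 0) ≡ c * (if Adj G v w ∧ isPos (f w) then 1 else 0)
    nbr≡ w with Adj G v w | f w | positive≡c w
    ... | false | _     | _   = ≡-sym (*-zeroʳ c)
    ... | true  | zero  | _   = ≡-sym (*-zeroʳ c)
    ... | true  | suc _ | f≡c = trans (f≡c refl) (≡-sym (*-identityʳ c))

  independentKRDF-support-≥k : ∀ k f → IsIndependentKRDF k G f →
                               ∀ v → support f v ≡ true → k ≤ f v
  independentKRDF-support-≥k k f ((_ , condition) , indep) v act = ≮⇒≥ fv≮k
    where
    fv≮k : ¬ f v < k
    fv≮k fv<k = <⇒≱ fv<k (begin
      k                     ≤⟨ m≤m+n k _ ⟩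
      k + activeNbrs G f v  ≤⟨ condition v fv<k ⟩
      f v + openNbhdSum f v ≡⟨ cong (f v +_) (openNbhdSum-≡0 f v indep act) ⟩
      f v + 0               ≡⟨ +-identityʳ (f v) ⟩
      f v                   ∎)
      where open ≤-Reasoning

  KRDF-support-isDominating : ∀ k f → 1 ≤ k → IsKRDF k G f → IsDominating G (support f)
  KRDF-support-isDominating k f 1≤k (_ , condition) v inactive =
    1≤openNbhdSum⇒∃activeNbr f v (begin
      1                     ≤⟨ 1≤k ⟩
      k                     ≤⟨ m≤m+n k _ ⟩
      k + activeNbrs G f v  ≤⟨ condition v fv<k ⟩
      f v + openNbhdSum f v ≡⟨ cong (_+ openNbhdSum f v) fv≡0 ⟩
      openNbhdSum f v       ∎)
    where
    open ≤-Reasoning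
    fv≡0 : f v ≡ 0
    fv≡0 = isPos≡false⇒≡0 (f v) inactive
    fv<k : f v < k
    fv<k = subst (_< k) (≡-sym fv≡0) 1≤k

  *-card-support≤weight : ∀ k f → (∀ v → support f v ≡ true → k ≤ f v) →
                          k * card G (support f) ≤ weight G f
  *-card-support≤weight k f support⇒≥k = begin
    k * card G (support f)                                  ≡⟨ sumFin-*ˡ (n G) k _ ⟨
    sumFin (n G) (λ v → k * (if support f v then 1 else 0)) ≤⟨ sumFin-mono (n G) pointwise ⟩
    weight G f                                              ∎
    where
    open ≤-Reasoning
    pointwise : ∀ v → k * (if support f v then 1 else 0) ≤ f v
    pointwise v with support f v in act
    ... | true  = subst (_≤ f v) (≡-sym (*-identityʳ k)) (support⇒≥k v act)
    ... | false = subst (_≤ f v) (≡-sym (*-zeroʳ k)) z≤n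

  scaledIndicator-isIndependentKRDF : ∀ k S → IsIndDomSet G S →
                                      IsIndependentKRDF k G (scaledIndicator (suc k) S)
  scaledIndicator-isIndependentKRDF k S (indep , dom) = (bounded , condition) , independent
    where
    f = scaledIndicator (suc k) S
    bounded : ∀ v → f v ≤ suc k
    bounded v with S v
    ... | true  = ≤-refl
    ... | false = z≤n
    condition : ∀ v → f v < k → k + activeNbrs G f v ≤ closedNbhdSum G f v
    condition v fv<k with S v in sv
    ... | true  = contradiction fv<k (<-asym (n<1+n k))
    ... | false with dom v sv
    ...   | w , adj , sw = begin
      k + activeNbrs G f v     ≤⟨ m+n≤[1+m]*n k _ (activeNbr⇒1≤activeNbrs f v w adj w-active) ⟩
      suc k * activeNbrs G f v ≡⟨ openNbhdSum-≡-*activeNbrs (suc k) f v (scaledIndicator-on-support (suc k) S) ⟨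
      openNbhdSum f v          ∎
      where
      open ≤-Reasoning
      w-active : support f w ≡ true
      w-active = trans (support-scaledIndicator k S w) sw
    independent : IsIndependent G (support f)
    independent u v adj act = trans (support-scaledIndicator k S v)
      (indep u v adj (trans (≡-sym (support-scaledIndicator k S u)) act))

  k*i≤i[kR] : ∀ k {a b} → 1 ≤ k → IsIndDomNumber G a → IsIndKRomanNumber k G b → k * a ≤ b
  k*i≤i[kR] k {a} {b} 1≤k (_ , a-minimal) ((f , (krdf , indep) , weight≡b) , _) = begin
    k * a                  ≤⟨ *-monoʳ-≤ k (a-minimal (support f) (indep , support-dominating)) ⟩
    k * card G (support f) ≤⟨ *-card-support≤weight k f (independentKRDF-support-≥k k f (krdf , indep)) ⟩
    weight G f             ≡⟨ weight≡b ⟩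
    b                      ∎
    where
    open ≤-Reasoning
    support-dominating : IsDominating G (support f)
    support-dominating = KRDF-support-isDominating k f 1≤k krdf

  i[kR]≤[1+k]*i : ∀ k {a b} → IsIndDomNumber G a → IsIndKRomanNumber k G b → b ≤ suc k * a
  i[kR]≤[1+k]*i k {a} {b} ((S , isIndDom , card≡a) , _) (_ , b-minimal) = begin
    b                                    ≤⟨ b-minimal _ (scaledIndicator-isIndependentKRDF k S isIndDom) ⟩
    weight G (scaledIndicator (suc k) S) ≡⟨ sumFin-scaledIndicator (n G) (suc k) S ⟩
    suc k * card G S                     ≡⟨ cong (suc k *_) card≡a ⟩
    suc k * a                            ∎
    where open ≤-Reasoning

proposition3p1 : (k : ℕ) → 1 ≤ k → (G : Graph) → (a b : ℕ)
  → IsIndDomNumber G a → IsIndKRomanNumber k G b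
  → (k * a ≤ b) × (b ≤ suc k * a)
proposition3p1 k 1≤k G a b a-is-i b-is-i[kR] =
  k*i≤i[kR] G k 1≤k a-is-i b-is-i[kR] , i[kR]≤[1+k]*i G k a-is-i b-is-i[kR]
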